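{- Let $\mathcal{D}=(B_x:x\in V(T))$ be a refined tree-decomposition of a graph $G$. For all nodes $x,y\in V(T)$ (not necessarily distinct) and every subset $S\subseteq B_y$, the bag $B_x$ intersects exactly one component of $G-S$, unless $x=y$ and $S=B_y$.
   Context: A tree-decomposition $(B_x:x\in V(T))$ is normal if $B_x\not\subseteq B_y$ for every edge $xy\in E(T)$. A tree-decomposition $\mathcal{D}'$ of $G$ is a refinement of a tree-decomposition $\mathcal{D}$ of $G$ if every bag of $\mathcal{D}'$ is a subset of some bag of $\mathcal{D}$; it is a proper refinement if moreover $\mathcal{D}$ is not a refinement of $\mathcal{D}'$. A tree-decomposition is refined if it is normal and has no proper refinement. -}

module Defs where

open import Data.Nat using (ℕ; suc)
open import Data.Bool using (Bool; true; false)
open import Data.Fin using (Fin)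
open import Data.Fin.Subset using (Subset; _∈_; _∉_; _⊆_)
open import Data.List using (List; _∷_; [])
open import Data.List.Relation.Unary.Linked using (Linked)
open import Data.List.Relation.Unary.Unique.Propositional using (Unique)
open import Data.Product using (Σ; ∃; _×_; _,_)
open import Relation.Nullary using (¬_)
open import Relation.Binary.PropositionalEquality using (_≡_)

record Graph (n : ℕ) : Set where
  field
    adj     : Fin n → Fin n → Bool
    sym     : ∀ u v → adj u v ≡ adj v u
    irrefl  : ∀ v → adj v v ≡ false

Edge : ∀ {n} → Graph n → Fin n → Fin n → Set
Edge G u v = Graph.adj G u v ≡ true

-- Reach G P u v : there is a path from u to v in G all of whose vertices satisfy P
-- (i.e. a path in the induced subgraph G[P]).
data Reach {n} (G : Graph n) (P : Fin n → Set) : Fin n → Fin n → Set where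
  here : ∀ {v} → P v → Reach G P v v
  step : ∀ {u w v} → P u → Edge G u w → Reach G P w v → Reach G P u v

Connected : ∀ {n} → Graph n → Set
Connected G = ∀ x y → Reach G (λ _ → Data.Unit.⊤) x y
  where import Data.Unit

last : ∀ {A : Set} → A → List A → A
last a [] = a
last a (b ∷ bs) = last b bs

IsCycle : ∀ {n} → Graph n → List (Fin n) → Set
IsCycle G [] = Data.Empty.⊥
  where import Data.Empty
IsCycle G (_ ∷ []) = Data.Empty.⊥
  where import Data.Empty
IsCycle G (_ ∷ _ ∷ []) = Data.Empty.⊥
  where import Data.Empty
IsCycle G (x ∷ xs@(_ ∷ _ ∷ _)) =
  Unique (x ∷ xs) × Linked (Edge G) (x ∷ xs) × Edge G (last x xs) x

Acyclic : ∀ {n} → Graph n → Set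
Acyclic G = ∀ cs → ¬ IsCycle G cs

record Tree (m : ℕ) : Set where
  field
    graph     : Graph m
    connected : Connected graph
    acyclic   : Acyclic graph

TEdge : ∀ {m} → Tree m → Fin m → Fin m → Set
TEdge T = Edge (Tree.graph T)

record TreeDecomposition {n} (G : Graph n) : Set where
  field
    m      : ℕ
    tree   : Tree m
    bag    : Fin m → Subset n
    cover  : ∀ v → ∃ λ x → v ∈ bag x
    edges  : ∀ u v → Edge G u v → ∃ λ x → (u ∈ bag x × v ∈ bag x)
    subtree : ∀ v x y → v ∈ bag x → v ∈ bag y →
              Reach (Tree.graph tree) (λ z → v ∈ bag z) x y

open TreeDecomposition public

Normal : ∀ {n} {G : Graph n} → TreeDecomposition G → Set
Normal D = ∀ x y → TEdge (tree D) x y → ¬ (bag D x ⊆ bag D y)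

_Refines_ : ∀ {n} {G : Graph n} → TreeDecomposition G → TreeDecomposition G → Set
D' Refines D = ∀ x' → ∃ λ x → bag D' x' ⊆ bag D x

_ProperlyRefines_ : ∀ {n} {G : Graph n} → TreeDecomposition G → TreeDecomposition G → Set
D' ProperlyRefines D = D' Refines D × ¬ (D Refines D')

Refined : ∀ {n} {G : Graph n} → TreeDecomposition G → Set
Refined {G = G} D = Normal D × ((D' : TreeDecomposition G) → ¬ (D' ProperlyRefines D))

IsComponent : ∀ {n} → Graph n → Subset n → Subset n → Set
IsComponent G S C =
  Σ _ λ v → v ∉ S × (∀ u → (u ∈ C → Reach G (λ w → w ∉ S) v u)
                          × (Reach G (λ w → w ∉ S) v u → u ∈ C))

Meets : ∀ {n} → Subset n → Subset n → Set
Meets C B = ∃ λ v → v ∈ C × v ∈ B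

MeetsExactlyOneComponent : ∀ {n} → Graph n → Subset n → Subset n → Set
MeetsExactlyOneComponent G S B =
  Σ _ λ C → IsComponent G S C × Meets C B ×
    (∀ C' → IsComponent G S C' → Meets C' B → C' ≡ C)

{-# OPTIONS --safe #-}
-- If B_x ⊆ S ⊆ B_y, normality forces x = y (a bag contained in another bag is contained in
-- its neighbour on the path towards it), hence S = B_y; so B_x meets some component C of
-- G − S.  If B_x also met a vertex outside C ∪ S, then (C ∪ S, V − C) would be a separation
-- whose separator lies in B_y.  Taking two copies of T joined by an edge between the copies
-- of y, with bags B_z ∩ (C ∪ S) on the first copy and B_z − C on the second, gives a
-- tree-decomposition refining D in which no bag contains B_x: a proper refinement.
module Submission where

open import Defs
open import Data.Nat using (ℕ; suc; _+_; _≤_; _<_; s≤s; z≤n; s≤s⁻¹)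
open import Data.Nat.Properties using (<-≤-trans; n<1+n)
open import Data.Bool using (Bool; true; false; _∧_)
import Data.Bool as Bool
open import Data.Fin using (Fin; _≟_; splitAt; join)
open import Data.Fin.Properties using (any?; splitAt-join; join-splitAt)
open import Data.Fin.Subset using (Subset; _∈_; _∉_; _⊆_; _∩_; _∪_; ∁; _-_; ∣_∣)
open import Data.Fin.Subset.Properties
  using (_∈?_; ⊆-antisym; x∈p∩q⁺; x∈p∩q⁻; p∩q⊆p; p∩q⊆q; x∈p∪q⁺; x∈p∪q⁻; x∈∁p⇒x∉p; x∉p⇒x∈∁p;
         x∈p∧x≢y⇒x∈p-y; x∈p⇒p-x⊂p; x∈p⇒∣p-x∣<∣p∣)
open import Data.List using (List; []; _∷_; _++_; map; length)
open import Data.List.Properties using (++-assoc; ++-identityʳ; map-++; length-map; length-++-comm)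
open import Data.List.Membership.Propositional using () renaming (_∈_ to _∈ₗ_; _∉_ to _∉ₗ_)
open import Data.List.Membership.Propositional.Properties using (∈-∃++)
import Data.List.Membership.DecPropositional as DecMembership
open import Data.List.Relation.Unary.All using (All; []; _∷_)
open import Data.List.Relation.Unary.All.Properties using (¬Any⇒All¬; All¬⇒¬Any)
open import Data.List.Relation.Unary.Any using (here; there)
open import Data.List.Relation.Unary.AllPairs using ([]; _∷_)
open import Data.List.Relation.Unary.Linked using (Linked; []; [-]; _∷_)
import Data.List.Relation.Unary.Linked.Properties as Linked
open import Data.List.Relation.Unary.Unique.Propositional using (Unique)
import Data.List.Relation.Unary.Unique.Propositional.Properties as Unique
open import Data.Product using (Σ; ∃; _×_; _,_; proj₁; proj₂)
open import Data.Sum using (_⊎_; inj₁; inj₂; [_,_]′; reduce)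
import Data.Sum.Properties as Sum
open import Data.Unit using (⊤; tt)
open import Data.Empty using (⊥; ⊥-elim)
open import Data.Vec using (tabulate)
open import Data.Vec.Properties using (lookup∘tabulate; lookup⇒[]=; []=⇒lookup)
open import Function using (_∘_; id)
open import Relation.Nullary using (¬_; Dec; yes; no; does)
open import Relation.Nullary.Decidable using (_×-dec_; ¬?; dec-true; map′)
open import Relation.Binary.PropositionalEquality
  using (_≡_; _≢_; refl; sym; trans; cong; cong₂; subst; subst₂)

toSubset : ∀ {n} {P : Fin n → Set} → (∀ u → Dec (P u)) → Subset n
toSubset P? = tabulate (λ u → does (P? u))

module _ {n} {P : Fin n → Set} (P? : ∀ u → Dec (P u)) where

  ∈-toSubset⁺ : ∀ {u} → P u → u ∈ toSubset P?
  ∈-toSubset⁺ {u} p = lookup⇒[]= u _ (trans (lookup∘tabulate _ u) (dec-true (P? u) p))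

  ∈-toSubset⁻ : ∀ {u} → u ∈ toSubset P? → P u
  ∈-toSubset⁻ {u} u∈ with P? u | trans (sym ([]=⇒lookup u∈)) (lookup∘tabulate _ u)
  ... | yes p | _ = p
  ... | no _  | ()

⊈⇒∃∉ : ∀ {n} {p q : Subset n} → ¬ (p ⊆ q) → ∃ λ u → u ∈ p × u ∉ q
⊈⇒∃∉ {p = p} {q} p⊈q with any? (λ u → (u ∈? p) ×-dec ¬? (u ∈? q))
... | yes witness = witness
... | no none = ⊥-elim (p⊈q p⊆q)
  where
  p⊆q : p ⊆ q
  p⊆q {u} u∈p with u ∈? q
  ... | yes u∈q = u∈q
  ... | no u∉q = ⊥-elim (none (u , u∈p , u∉q))

Reach-map : ∀ {n n′} {G : Graph n} {H : Graph n′} {P : Fin n → Set} {Q : Fin n′ → Set}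
            (f : Fin n → Fin n′) → (∀ {u v} → Edge G u v → Edge H (f u) (f v)) →
            (∀ {u} → P u → Q (f u)) → ∀ {a b} → Reach G P a b → Reach H Q (f a) (f b)
Reach-map f f-edge f-pred (here p)     = here (f-pred p)
Reach-map f f-edge f-pred (step p e r) = step (f-pred p) (f-edge e) (Reach-map f f-edge f-pred r)

module Paths {n} (G : Graph n) where

  open DecMembership (_≟_ {n}) using () renaming (_∈?_ to _∈ₗ?_)

  Edge-sym : ∀ {u v} → Edge G u v → Edge G v u
  Edge-sym {u} {v} = trans (Graph.sym G v u)

  Edge? : ∀ u v → Dec (Edge G u v)
  Edge? u v = Graph.adj G u v Bool.≟ true

  Reach-mono : ∀ {P Q : Fin n → Set} → (∀ {u} → P u → Q u) → ∀ {a b} → Reach G P a b → Reach G Q a b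
  Reach-mono = Reach-map id id

  Reach-start : ∀ {P a b} → Reach G P a b → P a
  Reach-start (here p)     = p
  Reach-start (step p _ _) = p

  Reach-end : ∀ {P a b} → Reach G P a b → P b
  Reach-end (here p)     = p
  Reach-end (step _ _ r) = Reach-end r

  Reach-trans : ∀ {P a b c} → Reach G P a b → Reach G P b c → Reach G P a c
  Reach-trans (here _)     s = s
  Reach-trans (step p e r) s = step p e (Reach-trans r s)

  Reach-sym : ∀ {P a b} → Reach G P a b → Reach G P b a
  Reach-sym (here p)     = here p
  Reach-sym (step p e r) = Reach-trans (Reach-sym r) (step (Reach-start r) (Edge-sym e) (here p))

  vertices : ∀ {P a b} → Reach G P a b → List (Fin n)
  vertices (here {v} _)     = v ∷ []
  vertices (step {u} _ _ r) = u ∷ vertices r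

  Simple : ∀ {P a b} → Reach G P a b → Set
  Simple r = Unique (vertices r)

  All-vertices : ∀ {P a b} (r : Reach G P a b) → All P (vertices r)
  All-vertices (here p)     = p ∷ []
  All-vertices (step p _ r) = p ∷ All-vertices r

  vertices-linked : ∀ {P x a b} → Edge G x a → (r : Reach G P a b) → Linked (Edge G) (x ∷ vertices r)
  vertices-linked e (here _)      = e ∷ [-]
  vertices-linked e (step _ e′ r) = e ∷ vertices-linked e′ r

  last-vertices : ∀ {P a b} x (r : Reach G P a b) → last x (vertices r) ≡ b
  last-vertices x (here _)     = refl
  last-vertices x (step _ _ r) = last-vertices _ r

  Reach-∩ : ∀ {P Q a b} (r : Reach G P a b) → All Q (vertices r) → Reach G (λ u → P u × Q u) a b
  Reach-∩ (here p)     (q ∷ [])  = here (p , q)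
  Reach-∩ (step p e r) (q ∷ qs) = step (p , q) e (Reach-∩ r qs)

  Simple-suffix : ∀ {P u w b} (s : Reach G P w b) → u ∈ₗ vertices s → Simple s →
                  Σ (Reach G P u b) Simple
  Simple-suffix (here p)     (here refl) simple         = here p , simple
  Simple-suffix (step p e s) (here refl) simple         = step p e s , simple
  Simple-suffix (step _ _ s) (there u∈s) (_ ∷ simple) = Simple-suffix s u∈s simple

  Reach-simple : ∀ {P a b} → Reach G P a b → Σ (Reach G P a b) Simple
  Reach-simple (here p) = here p , [] ∷ []
  Reach-simple (step {u} p e r) with Reach-simple r
  ... | s , s-simple with u ∈ₗ? vertices s
  ...   | yes u∈s = Simple-suffix s u∈s s-simple
  ...   | no u∉s  = step p e s , ¬Any⇒All¬ _ u∉s ∷ s-simple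

  Reach-first-step : ∀ {P a b} → Reach G P a b →
                     a ≡ b ⊎ ∃ λ w → Edge G a w × Reach G (λ u → P u × a ≢ u) w b
  Reach-first-step r with Reach-simple r
  ... | here _ , _                 = inj₁ refl
  ... | step _ e s , s-avoids ∷ _ = inj₂ (_ , e , Reach-∩ s s-avoids)

  closes-cycle : ∀ {x a b} → Edge G x a → Edge G b x → (q : Reach G (x ≢_) a b) → Simple q →
                 Unique (x ∷ vertices q) × Linked (Edge G) (x ∷ vertices q) × Edge G (last x (vertices q)) x
  closes-cycle {x} xa bx q simple =
    All-vertices q ∷ simple , vertices-linked xa q , subst (λ z → Edge G z x) (sym (last-vertices x q)) bx

  Reach-∈-first-step : ∀ {A a b} → a ≢ b → Reach G (_∈ A) a b →
                       ∃ λ w → Edge G a w × Reach G (_∈ A - a) w b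
  Reach-∈-first-step a≢b r with Reach-first-step r
  ... | inj₁ a≡b          = ⊥-elim (a≢b a≡b)
  ... | inj₂ (w , e , r′) = w , e , Reach-mono (λ (u∈A , a≢u) → x∈p∧x≢y⇒x∈p-y u∈A (a≢u ∘ sym)) r′

  Reach?-∈ : (A : Subset n) → ∀ a b → Dec (Reach G (_∈ A) a b)
  Reach?-∈ A = bounded (suc ∣ A ∣) A (n<1+n ∣ A ∣)
    where
    bounded : ∀ k (A : Subset n) → ∣ A ∣ < k → ∀ a b → Dec (Reach G (_∈ A) a b)
    bounded (suc k) A ∣A∣<1+k a b with a ∈? A | a ≟ b
    ... | no a∉A  | _        = no (a∉A ∘ Reach-start)
    ... | yes a∈A | yes refl = yes (here a∈A)
    ... | yes a∈A | no a≢b   =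
      map′ (λ (w , e , r) → step a∈A e (Reach-mono (proj₁ (x∈p⇒p-x⊂p a∈A)) r))
           (Reach-∈-first-step a≢b)
           (any? λ w → Edge? a w ×-dec bounded k (A - a) ∣A-a∣<k w b)
      where
      ∣A-a∣<k : ∣ A - a ∣ < k
      ∣A-a∣<k = <-≤-trans (x∈p⇒∣p-x∣<∣p∣ a∈A) (s≤s⁻¹ ∣A∣<1+k)

last-∷ʳ : ∀ {A : Set} (x : A) xs y → last x (xs ++ y ∷ []) ≡ y
last-∷ʳ x []       y = refl
last-∷ʳ x (z ∷ zs) y = last-∷ʳ z zs y

last-map : ∀ {A B : Set} (f : A → B) x xs → last (f x) (map f xs) ≡ f (last x xs)
last-map f x []       = refl
last-map f x (y ∷ ys) = last-map f y ys

last-∈ : ∀ {A : Set} (x : A) xs → last x xs ∈ₗ x ∷ xs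
last-∈ x []       = here refl
last-∈ x (y ∷ ys) = there (last-∈ y ys)

Unique⇒last≢head : ∀ {A : Set} {x y : A} ys → Unique (x ∷ y ∷ ys) → last y ys ≢ x
Unique⇒last≢head {y = y} ys unique refl = Unique.Unique[x∷xs]⇒x∉xs unique (last-∈ y ys)

module _ {A : Set} {R : A → A → Set} where

  Linked-∷ʳ⁺ : ∀ {x y} xs → Linked R (x ∷ xs) → R (last x xs) y → Linked R (x ∷ xs ++ y ∷ [])
  Linked-∷ʳ⁺ []       [-]      r = r ∷ [-]
  Linked-∷ʳ⁺ (_ ∷ xs) (r ∷ rs) r′ = r ∷ Linked-∷ʳ⁺ xs rs r′

  Linked-∷ʳ⁻ : ∀ {x y} xs → Linked R (x ∷ xs ++ y ∷ []) → Linked R (x ∷ xs) × R (last x xs) y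
  Linked-∷ʳ⁻ []       (r ∷ [-]) = [-] , r
  Linked-∷ʳ⁻ (_ ∷ xs) (r ∷ rs)  = let (rs′ , r′) = Linked-∷ʳ⁻ xs rs in r ∷ rs′ , r′

-- A cycle x₀ … x_k of an arbitrary relation, encoded by the closed walk x₀ … x_k x₀;
-- unlike IsCycle, this form is invariant under rotation.
Cycle : ∀ {A : Set} → (A → A → Set) → List A → Set
Cycle R []       = ⊥
Cycle R (x ∷ xs) = Unique (x ∷ xs) × Linked R (x ∷ xs ++ x ∷ []) × 2 ≤ length xs

module _ {n} {G : Graph n} where

  IsCycle⇒Cycle : ∀ xs → IsCycle G xs → Cycle (Edge G) xs
  IsCycle⇒Cycle (x ∷ y ∷ z ∷ zs) (unique , linked , closing) =
    unique , Linked-∷ʳ⁺ (y ∷ z ∷ zs) linked closing , s≤s (s≤s z≤n)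

  Cycle⇒IsCycle : ∀ xs → Cycle (Edge G) xs → IsCycle G xs
  Cycle⇒IsCycle (x ∷ y ∷ z ∷ zs) (unique , linked , _) = unique , Linked-∷ʳ⁻ (y ∷ z ∷ zs) linked
  Cycle⇒IsCycle (x ∷ y ∷ [])     (_ , _ , s≤s ())

module _ {A : Set} {R : A → A → Set} where

  Cycle-rotate₁ : ∀ {x} xs → Cycle R (x ∷ xs) → Cycle R (xs ++ x ∷ [])
  Cycle-rotate₁ {x} (y ∷ ys) (x∉ ∷ unique , r ∷ linked , long) =
    Unique.++⁺ unique ([] ∷ []) (λ { (x∈ , here refl) → All¬⇒¬Any x∉ x∈ }) ,
    Linked-∷ʳ⁺ (ys ++ x ∷ []) linked (subst (λ z → R z y) (sym (last-∷ʳ y ys x)) r) ,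
    subst (2 ≤_) (length-++-comm (x ∷ []) ys) long

  Cycle-rotate : ∀ xs {a} ys → Cycle R (xs ++ a ∷ ys) → Cycle R (a ∷ ys ++ xs)
  Cycle-rotate []       {a} ys c = subst (λ zs → Cycle R (a ∷ zs)) (sym (++-identityʳ ys)) c
  Cycle-rotate (x ∷ xs) {a} ys c =
    subst (λ zs → Cycle R (a ∷ zs)) (++-assoc ys (x ∷ []) xs)
      (Cycle-rotate xs (ys ++ x ∷ [])
        (subst (Cycle R) (++-assoc xs (a ∷ ys) (x ∷ [])) (Cycle-rotate₁ (xs ++ a ∷ ys) c)))

module _ {A B : Set} {R : A → A → Set} {R′ : B → B → Set} (f : A → B) where

  Cycle-map⁺ : (∀ {x y} → f x ≡ f y → x ≡ y) → (∀ {x y} → R x y → R′ (f x) (f y)) →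
               ∀ xs → Cycle R xs → Cycle R′ (map f xs)
  Cycle-map⁺ f-inj f-hom (x ∷ xs) (unique , linked , long) =
    Unique.map⁺ f-inj unique ,
    subst (λ ys → Linked R′ (f x ∷ ys)) (map-++ f xs (x ∷ [])) (Linked.map⁺ (lift linked)) ,
    subst (2 ≤_) (sym (length-map f xs)) long
    where
    lift : ∀ {ys} → Linked R ys → Linked (λ u v → R′ (f u) (f v)) ys
    lift []       = []
    lift [-]      = [-]
    lift (r ∷ rs) = f-hom r ∷ lift rs

  Cycle-map⁻ : (∀ {x y} → R′ (f x) (f y) → R x y) → ∀ xs → Cycle R′ (map f xs) → Cycle R xs
  Cycle-map⁻ f-refl (x ∷ xs) (unique , linked , long) =
    Unique.map⁻ unique ,
    lower (Linked.map⁻ (subst (λ ys → Linked R′ (f x ∷ ys)) (sym (map-++ f xs (x ∷ []))) linked)) ,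
    subst (2 ≤_) (length-map f xs) long
    where
    lower : ∀ {ys} → Linked (λ u v → R′ (f u) (f v)) ys → Linked R ys
    lower []       = []
    lower [-]      = [-]
    lower (r ∷ rs) = f-refl r ∷ lower rs

module _ {n} {G : Graph n} (acyclic : Acyclic G) where
  open Paths G

  acyclic⇒neighbours-≡ : ∀ {x a b} → Edge G x a → Edge G x b → Reach G (x ≢_) a b → a ≡ b
  acyclic⇒neighbours-≡ xa xb r with Reach-simple r
  ... | here _ , _                          = refl
  -- two clauses, so that IsCycle G (x ∷ vertices q) computes
  ... | q@(step _ _ (here _))     , simple = ⊥-elim (acyclic _ (closes-cycle xa (Edge-sym xb) q simple))
  ... | q@(step _ _ (step _ _ _)) , simple = ⊥-elim (acyclic _ (closes-cycle xa (Edge-sym xb) q simple))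

  Reach-visits-first-step : ∀ {P x y z} → Edge G x z → Reach G (x ≢_) z y → Reach G P x y → P z
  Reach-visits-first-step xz z⇝y x⇝y with Reach-first-step x⇝y
  ... | inj₁ refl = ⊥-elim (Reach-end z⇝y refl)
  ... | inj₂ (w , xw , w⇝y)
    with acyclic⇒neighbours-≡ xz xw (Reach-trans z⇝y (Reach-sym (Reach-mono proj₂ w⇝y)))
  ...   | refl = proj₁ (Reach-start w⇝y)

module _ {n} {G : Graph n} (D : TreeDecomposition G) where
  open Paths (Tree.graph (tree D))

  normal⇒bag-⊆⇒≡ : Normal D → ∀ {x y} → bag D x ⊆ bag D y → x ≡ y
  normal⇒bag-⊆⇒≡ normal {x} {y} Bx⊆By with Reach-first-step (Tree.connected (tree D) x y)
  ... | inj₁ x≡y           = x≡y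
  ... | inj₂ (z , xz , z⇝y) = ⊥-elim (normal x z xz λ {u} u∈Bx →
          Reach-visits-first-step (Tree.acyclic (tree D)) xz (Reach-mono proj₂ z⇝y)
            (subtree D u x y u∈Bx (Bx⊆By u∈Bx)))

module JoinedTree {m₁ m₂} (T₁ : Tree m₁) (y₁ : Fin m₁) (T₂ : Tree m₂) (y₂ : Fin m₂) where
  private
    G₁ : Graph m₁
    G₁ = Tree.graph T₁

    G₂ : Graph m₂
    G₂ = Tree.graph T₂

  Node : Set
  Node = Fin m₁ ⊎ Fin m₂

  node : Node → Fin (m₁ + m₂)
  node = join m₁ m₂

  atNode : ∀ {P : Node → Set} s → P s → P (splitAt m₁ (node s))
  atNode {P} s = subst P (sym (splitAt-join m₁ m₂ s))

  data JoinEdge : Node → Node → Set where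
    left    : ∀ {a b} → Edge G₁ a b → JoinEdge (inj₁ a) (inj₁ b)
    right   : ∀ {a b} → Edge G₂ a b → JoinEdge (inj₂ a) (inj₂ b)
    bridge  : JoinEdge (inj₁ y₁) (inj₂ y₂)
    bridge′ : JoinEdge (inj₂ y₂) (inj₁ y₁)

  isBridge : Fin m₁ → Fin m₂ → Bool
  isBridge a b = does (a ≟ y₁) ∧ does (b ≟ y₂)

  isBridge-ends : isBridge y₁ y₂ ≡ true
  isBridge-ends = cong₂ _∧_ (dec-true (y₁ ≟ y₁) refl) (dec-true (y₂ ≟ y₂) refl)

  adjᴺ : Node → Node → Bool
  adjᴺ (inj₁ a) (inj₁ b) = Graph.adj G₁ a b
  adjᴺ (inj₂ a) (inj₂ b) = Graph.adj G₂ a b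
  adjᴺ (inj₁ a) (inj₂ b) = isBridge a b
  adjᴺ (inj₂ b) (inj₁ a) = isBridge a b

  adjᴺ-sym : ∀ s t → adjᴺ s t ≡ adjᴺ t s
  adjᴺ-sym (inj₁ a) (inj₁ b) = Graph.sym G₁ a b
  adjᴺ-sym (inj₂ a) (inj₂ b) = Graph.sym G₂ a b
  adjᴺ-sym (inj₁ a) (inj₂ b) = refl
  adjᴺ-sym (inj₂ b) (inj₁ a) = refl

  adjᴺ-irrefl : ∀ s → adjᴺ s s ≡ false
  adjᴺ-irrefl (inj₁ a) = Graph.irrefl G₁ a
  adjᴺ-irrefl (inj₂ b) = Graph.irrefl G₂ b

  graph : Graph (m₁ + m₂)
  graph = record
    { adj    = λ i j → adjᴺ (splitAt m₁ i) (splitAt m₁ j)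
    ; sym    = λ i j → adjᴺ-sym (splitAt m₁ i) (splitAt m₁ j)
    ; irrefl = adjᴺ-irrefl ∘ splitAt m₁
    }

  private
    module H = Paths graph
    open DecMembership (Sum.≡-dec (_≟_ {m₁}) (_≟_ {m₂})) using () renaming (_∈?_ to _∈ᴺ?_)

  adjᴺ⇒JoinEdge : ∀ s t → adjᴺ s t ≡ true → JoinEdge s t
  adjᴺ⇒JoinEdge (inj₁ a) (inj₁ b) e = left e
  adjᴺ⇒JoinEdge (inj₂ a) (inj₂ b) e = right e
  adjᴺ⇒JoinEdge (inj₁ a) (inj₂ b) e with a ≟ y₁ | b ≟ y₂
  adjᴺ⇒JoinEdge (inj₁ a) (inj₂ b) e  | yes refl | yes refl = bridge
  adjᴺ⇒JoinEdge (inj₁ a) (inj₂ b) () | yes _    | no _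
  adjᴺ⇒JoinEdge (inj₁ a) (inj₂ b) () | no _     | _
  adjᴺ⇒JoinEdge (inj₂ b) (inj₁ a) e with a ≟ y₁ | b ≟ y₂
  adjᴺ⇒JoinEdge (inj₂ b) (inj₁ a) e  | yes refl | yes refl = bridge′
  adjᴺ⇒JoinEdge (inj₂ b) (inj₁ a) () | yes _    | no _
  adjᴺ⇒JoinEdge (inj₂ b) (inj₁ a) () | no _     | _

  JoinEdge⇒adjᴺ : ∀ {s t} → JoinEdge s t → adjᴺ s t ≡ true
  JoinEdge⇒adjᴺ (left e)  = e
  JoinEdge⇒adjᴺ (right e) = e
  JoinEdge⇒adjᴺ bridge    = isBridge-ends
  JoinEdge⇒adjᴺ bridge′   = isBridge-ends

  Edge⇒JoinEdge : ∀ {i j} → Edge graph i j → JoinEdge (splitAt m₁ i) (splitAt m₁ j)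
  Edge⇒JoinEdge = adjᴺ⇒JoinEdge _ _

  JoinEdge⇒Edge : ∀ {s t} → JoinEdge s t → Edge graph (node s) (node t)
  JoinEdge⇒Edge {s} {t} e =
    subst₂ (λ s′ t′ → adjᴺ s′ t′ ≡ true) (sym (splitAt-join m₁ m₂ s)) (sym (splitAt-join m₁ m₂ t))
      (JoinEdge⇒adjᴺ e)

  Reach-left : ∀ {P : Node → Set} {a b} → Reach G₁ (P ∘ inj₁) a b →
               Reach graph (P ∘ splitAt m₁) (node (inj₁ a)) (node (inj₁ b))
  Reach-left {P} = Reach-map (node ∘ inj₁) (JoinEdge⇒Edge ∘ left) (λ {a} → atNode {P} (inj₁ a))

  Reach-right : ∀ {P : Node → Set} {a b} → Reach G₂ (P ∘ inj₂) a b →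
                Reach graph (P ∘ splitAt m₁) (node (inj₂ a)) (node (inj₂ b))
  Reach-right {P} = Reach-map (node ∘ inj₂) (JoinEdge⇒Edge ∘ right) (λ {b} → atNode {P} (inj₂ b))

  Reach-joined : ∀ {P : Node → Set} →
    (∀ {a b} → P (inj₁ a) → P (inj₁ b) → Reach G₁ (P ∘ inj₁) a b) →
    (∀ {a b} → P (inj₂ a) → P (inj₂ b) → Reach G₂ (P ∘ inj₂) a b) →
    (∀ {a b} → P (inj₁ a) → P (inj₂ b) → P (inj₁ y₁) × P (inj₂ y₂)) →
    ∀ i j → P (splitAt m₁ i) → P (splitAt m₁ j) → Reach graph (P ∘ splitAt m₁) i j
  Reach-joined {P} reach₁ reach₂ crossing i j pᵢ pⱼ =
    subst₂ (Reach graph (P ∘ splitAt m₁)) (join-splitAt m₁ m₂ i) (join-splitAt m₁ m₂ j) (reach _ _ pᵢ pⱼ)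
    where
    across : ∀ {a b} → P (inj₁ a) → P (inj₂ b) →
             Reach graph (P ∘ splitAt m₁) (node (inj₁ a)) (node (inj₂ b))
    across pa pb = let (p₁ , p₂) = crossing pa pb in
      H.Reach-trans (Reach-left {P} (reach₁ pa p₁))
        (step (atNode {P} (inj₁ y₁) p₁) (JoinEdge⇒Edge bridge) (Reach-right {P} (reach₂ p₂ pb)))

    reach : ∀ s t → P s → P t → Reach graph (P ∘ splitAt m₁) (node s) (node t)
    reach (inj₁ a) (inj₁ b) pa pb = Reach-left {P} (reach₁ pa pb)
    reach (inj₂ a) (inj₂ b) pa pb = Reach-right {P} (reach₂ pa pb)
    reach (inj₁ a) (inj₂ b) pa pb = across pa pb
    reach (inj₂ b) (inj₁ a) pb pa = H.Reach-sym (across pa pb)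

  connected : Connected graph
  connected i j =
    Reach-joined {λ _ → ⊤} (λ _ _ → Tree.connected T₁ _ _) (λ _ _ → Tree.connected T₂ _ _) (λ _ _ → tt , tt)
      i j tt tt

  stays-left : ∀ {a xs} → Linked JoinEdge (inj₁ a ∷ xs) → inj₁ y₁ ∉ₗ inj₁ a ∷ xs →
               ∃ λ l → xs ≡ map inj₁ l
  stays-left [-]               _      = [] , refl
  stays-left (left _ ∷ linked) avoids with stays-left linked (avoids ∘ there)
  ... | l , refl = _ ∷ l , refl
  stays-left (bridge ∷ _)      avoids = ⊥-elim (avoids (here refl))

  stays-right : ∀ {b xs} → Linked JoinEdge (inj₂ b ∷ xs) → inj₁ y₁ ∉ₗ xs →
                ∃ λ l → xs ≡ map inj₂ l
  stays-right [-]                _      = [] , refl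
  stays-right (right _ ∷ linked) avoids with stays-right linked (avoids ∘ there)
  ... | l , refl = _ ∷ l , refl
  stays-right (bridge′ ∷ _)      avoids = ⊥-elim (avoids (here refl))

  ¬Cycle-left : ∀ l → ¬ Cycle JoinEdge (map inj₁ l)
  ¬Cycle-left l c = Tree.acyclic T₁ l (Cycle⇒IsCycle l (Cycle-map⁻ inj₁ (λ { (left e) → e }) l c))

  ¬Cycle-right : ∀ l → ¬ Cycle JoinEdge (map inj₂ l)
  ¬Cycle-right l c = Tree.acyclic T₂ l (Cycle⇒IsCycle l (Cycle-map⁻ inj₂ (λ { (right e) → e }) l c))

  ¬Cycle-avoiding : ∀ xs → inj₁ y₁ ∉ₗ xs → ¬ Cycle JoinEdge xs
  ¬Cycle-avoiding (inj₁ a ∷ xs) avoids c@(_ , linked , _)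
    with stays-left (proj₁ (Linked-∷ʳ⁻ xs linked)) avoids
  ... | l , refl = ¬Cycle-left (a ∷ l) c
  ¬Cycle-avoiding (inj₂ b ∷ xs) avoids c@(_ , linked , _)
    with stays-right (proj₁ (Linked-∷ʳ⁻ xs linked)) (avoids ∘ there)
  ... | l , refl = ¬Cycle-right (b ∷ l) c

  bridge′-source : ∀ {b a} → JoinEdge (inj₂ b) (inj₁ a) → b ≡ y₂
  bridge′-source bridge′ = refl

  -- Leaving y₁ over the bridge, the cycle must also return over it, visiting inj₂ y₂ twice.
  ¬Cycle-over-bridge : ∀ l → ¬ Cycle JoinEdge (inj₁ y₁ ∷ inj₂ y₂ ∷ map inj₂ l)
  ¬Cycle-over-bridge []      (_ , _ , s≤s ())
  ¬Cycle-over-bridge (z ∷ l) (_ ∷ unique , _ ∷ linked , _) =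
    Unique⇒last≢head (map inj₂ l) unique
      (trans (last-map inj₂ z l) (cong inj₂ (bridge′-source returning)))
    where
    returning : JoinEdge (inj₂ (last z l)) (inj₁ y₁)
    returning = subst (λ s → JoinEdge s (inj₁ y₁)) (last-map inj₂ z l)
                  (proj₂ (Linked-∷ʳ⁻ (inj₂ z ∷ map inj₂ l) linked))

  ¬Cycle-from-y₁ : ∀ xs → ¬ Cycle JoinEdge (inj₁ y₁ ∷ xs)
  ¬Cycle-from-y₁ (x ∷ xs) c@(y₁∉ ∷ _ , e ∷ linked , _) with e
  ... | left _ with stays-left (proj₁ (Linked-∷ʳ⁻ xs linked)) (All¬⇒¬Any y₁∉)
  ...   | l , refl = ¬Cycle-left (y₁ ∷ _ ∷ l) c
  ¬Cycle-from-y₁ (x ∷ xs) c@(y₁∉ ∷ _ , e ∷ linked , _) | bridge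
    with stays-right (proj₁ (Linked-∷ʳ⁻ xs linked)) (All¬⇒¬Any y₁∉ ∘ there)
  ...   | l , refl = ¬Cycle-over-bridge l c

  ¬Cycle : ∀ xs → ¬ Cycle JoinEdge xs
  ¬Cycle xs c with inj₁ y₁ ∈ᴺ? xs
  ... | no y₁∉xs = ¬Cycle-avoiding xs y₁∉xs c
  ... | yes y₁∈xs with ∈-∃++ y₁∈xs
  ...   | ys , zs , refl = ¬Cycle-from-y₁ (zs ++ ys) (Cycle-rotate ys zs c)

  acyclic : Acyclic graph
  acyclic xs cycle =
    ¬Cycle (map (splitAt m₁) xs)
      (Cycle-map⁺ (splitAt m₁) splitAt-injective Edge⇒JoinEdge xs (IsCycle⇒Cycle xs cycle))
    where
    splitAt-injective : ∀ {i j} → splitAt m₁ i ≡ splitAt m₁ j → i ≡ j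
    splitAt-injective {i} {j} eq =
      trans (sym (join-splitAt m₁ m₂ i)) (trans (cong node eq) (join-splitAt m₁ m₂ j))

  joined : Tree (m₁ + m₂)
  joined = record { graph = graph ; connected = connected ; acyclic = acyclic }

record Separation {n} (G : Graph n) (K₁ K₂ : Subset n) : Set where
  field
    sides-cover      : ∀ u → u ∈ K₁ ⊎ u ∈ K₂
    edge-within-side : ∀ {u v} → Edge G u v → (u ∈ K₁ × v ∈ K₁) ⊎ (u ∈ K₂ × v ∈ K₂)

module Split {n} {G : Graph n} (D : TreeDecomposition G) (y : Fin (m D)) {K₁ K₂ : Subset n}
             (sep : Separation G K₁ K₂) (K₁∩K₂⊆B : ∀ {u} → u ∈ K₁ → u ∈ K₂ → u ∈ bag D y) where
  open Separation sep
  open JoinedTree (tree D) y (tree D) y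
  open Paths (Tree.graph (tree D)) using (Reach-mono)

  bagᴺ : Node → Subset n
  bagᴺ (inj₁ z) = bag D z ∩ K₁
  bagᴺ (inj₂ z) = bag D z ∩ K₂

  ∈-bagᴺ : ∀ {u} s → u ∈ bagᴺ s → u ∈ bagᴺ (splitAt (m D) (node s))
  ∈-bagᴺ {u} = atNode {λ s → u ∈ bagᴺ s}

  split : TreeDecomposition G
  split = record
    { m       = m D + m D
    ; tree    = joined
    ; bag     = bagᴺ ∘ splitAt (m D)
    ; cover   = cover′
    ; edges   = edges′
    ; subtree = subtree′
    }
    where
    cover′ : ∀ u → ∃ λ i → u ∈ bagᴺ (splitAt (m D) i)
    cover′ u with cover D u | sides-cover u
    ... | z , u∈B | inj₁ u∈K₁ = node (inj₁ z) , ∈-bagᴺ (inj₁ z) (x∈p∩q⁺ (u∈B , u∈K₁))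
    ... | z , u∈B | inj₂ u∈K₂ = node (inj₂ z) , ∈-bagᴺ (inj₂ z) (x∈p∩q⁺ (u∈B , u∈K₂))

    edges′ : ∀ u v → Edge G u v → ∃ λ i → u ∈ bagᴺ (splitAt (m D) i) × v ∈ bagᴺ (splitAt (m D) i)
    edges′ u v e with edges D u v e | edge-within-side e
    ... | z , u∈B , v∈B | inj₁ (u∈K₁ , v∈K₁) =
      node (inj₁ z) , ∈-bagᴺ (inj₁ z) (x∈p∩q⁺ (u∈B , u∈K₁)) , ∈-bagᴺ (inj₁ z) (x∈p∩q⁺ (v∈B , v∈K₁))
    ... | z , u∈B , v∈B | inj₂ (u∈K₂ , v∈K₂) =
      node (inj₂ z) , ∈-bagᴺ (inj₂ z) (x∈p∩q⁺ (u∈B , u∈K₂)) , ∈-bagᴺ (inj₂ z) (x∈p∩q⁺ (v∈B , v∈K₂))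

    subtree′ : ∀ u i j → u ∈ bagᴺ (splitAt (m D) i) → u ∈ bagᴺ (splitAt (m D) j) →
               Reach graph (λ k → u ∈ bagᴺ (splitAt (m D) k)) i j
    subtree′ u = Reach-joined {λ s → u ∈ bagᴺ s} within within crossing
      where
      within : ∀ {K a b} → u ∈ bag D a ∩ K → u ∈ bag D b ∩ K →
               Reach (Tree.graph (tree D)) (λ z → u ∈ bag D z ∩ K) a b
      within {K} {a} {b} u∈Ba∩K u∈Bb∩K =
        let (u∈Ba , u∈K) = x∈p∩q⁻ _ K u∈Ba∩K in
        Reach-mono (λ u∈Bz → x∈p∩q⁺ (u∈Bz , u∈K)) (subtree D u a b u∈Ba (proj₁ (x∈p∩q⁻ _ K u∈Bb∩K)))

      crossing : ∀ {a b} → u ∈ bag D a ∩ K₁ → u ∈ bag D b ∩ K₂ → u ∈ bag D y ∩ K₁ × u ∈ bag D y ∩ K₂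
      crossing u∈Ba∩K₁ u∈Bb∩K₂ =
        let u∈K₁ = proj₂ (x∈p∩q⁻ _ K₁ u∈Ba∩K₁)
            u∈K₂ = proj₂ (x∈p∩q⁻ _ K₂ u∈Bb∩K₂)
            u∈By = K₁∩K₂⊆B u∈K₁ u∈K₂
        in x∈p∩q⁺ (u∈By , u∈K₁) , x∈p∩q⁺ (u∈By , u∈K₂)

  split-refines : split Refines D
  split-refines i = reduce (splitAt (m D) i) , bagᴺ⊆ (splitAt (m D) i)
    where
    bagᴺ⊆ : ∀ s → bagᴺ s ⊆ bag D (reduce s)
    bagᴺ⊆ (inj₁ z) = p∩q⊆p (bag D z) K₁
    bagᴺ⊆ (inj₂ z) = p∩q⊆p (bag D z) K₂

  ¬Refines-split : ∀ {x u w} → u ∈ bag D x → u ∉ K₂ → w ∈ bag D x → w ∉ K₁ → ¬ (D Refines split)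
  ¬Refines-split {x} u∈Bx u∉K₂ w∈Bx w∉K₁ D⊑split with D⊑split x
  ... | i , Bx⊆ with splitAt (m D) i
  ...   | inj₁ z = w∉K₁ (p∩q⊆q (bag D z) K₁ (Bx⊆ w∈Bx))
  ...   | inj₂ z = u∉K₂ (p∩q⊆q (bag D z) K₂ (Bx⊆ u∈Bx))

refined⇒¬bag-straddles : ∀ {n} {G : Graph n} (D : TreeDecomposition G) → Refined D →
  ∀ {K₁ K₂} y → Separation G K₁ K₂ → (∀ {u} → u ∈ K₁ → u ∈ K₂ → u ∈ bag D y) →
  ∀ {x u w} → u ∈ bag D x → u ∉ K₂ → w ∈ bag D x → w ∉ K₁ → ⊥
refined⇒¬bag-straddles D (_ , no-proper-refinement) y sep K₁∩K₂⊆B u∈Bx u∉K₂ w∈Bx w∉K₁ =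
  no-proper-refinement split (split-refines , ¬Refines-split u∈Bx u∉K₂ w∈Bx w∉K₁)
  where open Split D y sep K₁∩K₂⊆B

module Components {n} (G : Graph n) (S : Subset n) where
  open Paths G

  Reach? : ∀ a b → Dec (Reach G (_∉ S) a b)
  Reach? a b = map′ (Reach-mono x∈∁p⇒x∉p) (Reach-mono x∉p⇒x∈∁p) (Reach?-∈ (∁ S) a b)

  component : Fin n → Subset n
  component v = toSubset (Reach? v)

  component-isComponent : ∀ {v} → v ∉ S → IsComponent G S (component v)
  component-isComponent {v} v∉S = v , v∉S , λ u → ∈-toSubset⁻ (Reach? v) , ∈-toSubset⁺ (Reach? v)

  module _ {C : Subset n} (C-comp : IsComponent G S C) where
    private
      reach : ∀ {u} → u ∈ C → Reach G (_∉ S) (proj₁ C-comp) u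
      reach {u} = proj₁ (proj₂ (proj₂ C-comp) u)

      reached : ∀ {u} → Reach G (_∉ S) (proj₁ C-comp) u → u ∈ C
      reached {u} = proj₂ (proj₂ (proj₂ C-comp) u)

    IsComponent-∉ : ∀ {u} → u ∈ C → u ∉ S
    IsComponent-∉ = Reach-end ∘ reach

    IsComponent-neighbour : ∀ {u w} → u ∈ C → Edge G u w → w ∈ C ∪ S
    IsComponent-neighbour {u} {w} u∈C e with w ∈? S
    ... | yes w∈S = x∈p∪q⁺ (inj₂ w∈S)
    ... | no w∉S  = x∈p∪q⁺ (inj₁ (reached (Reach-trans (reach u∈C) (step (IsComponent-∉ u∈C) e (here w∉S)))))

    IsComponent-⊆ : ∀ {C′} → IsComponent G S C′ → ∀ {u} → u ∈ C → u ∈ C′ → C′ ⊆ C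
    IsComponent-⊆ (_ , _ , spec′) {u} u∈C u∈C′ {w} w∈C′ =
      reached (Reach-trans (reach u∈C) (Reach-trans (Reach-sym (proj₁ (spec′ u) u∈C′)) (proj₁ (spec′ w) w∈C′)))

    component-separation : Separation G (C ∪ S) (∁ C)
    component-separation = record { sides-cover = sides-cover ; edge-within-side = edge-within-side }
      where
      sides-cover : ∀ u → u ∈ C ∪ S ⊎ u ∈ ∁ C
      sides-cover u with u ∈? C
      ... | yes u∈C = inj₁ (x∈p∪q⁺ (inj₁ u∈C))
      ... | no u∉C  = inj₂ (x∉p⇒x∈∁p u∉C)

      edge-within-side : ∀ {u w} → Edge G u w → (u ∈ C ∪ S × w ∈ C ∪ S) ⊎ (u ∈ ∁ C × w ∈ ∁ C)
      edge-within-side {u} {w} e with u ∈? C | w ∈? C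
      ... | yes u∈C | _       = inj₁ (x∈p∪q⁺ (inj₁ u∈C) , IsComponent-neighbour u∈C e)
      ... | no _    | yes w∈C = inj₁ (IsComponent-neighbour w∈C (Edge-sym e) , x∈p∪q⁺ (inj₁ w∈C))
      ... | no u∉C  | no w∉C  = inj₂ (x∉p⇒x∈∁p u∉C , x∉p⇒x∈∁p w∉C)

  IsComponent-≡ : ∀ {C C′} → IsComponent G S C → IsComponent G S C′ → ∀ {u} → u ∈ C → u ∈ C′ → C′ ≡ C
  IsComponent-≡ C-comp C′-comp u∈C u∈C′ =
    ⊆-antisym (IsComponent-⊆ C-comp C′-comp u∈C u∈C′) (IsComponent-⊆ C′-comp C-comp u∈C′ u∈C)

module _ {n} {G : Graph n} (D : TreeDecomposition G) where

  normal⇒bag-⊈-separator : Normal D → ∀ {x y S} → S ⊆ bag D y → ¬ (x ≡ y × S ≡ bag D y) →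
                           ∃ λ v → v ∈ bag D x × v ∉ S
  normal⇒bag-⊈-separator normal {x} {y} {S} S⊆By ¬x≡y×S≡By = ⊈⇒∃∉ λ Bx⊆S →
    let x≡y = normal⇒bag-⊆⇒≡ D normal (λ u∈Bx → S⊆By (Bx⊆S u∈Bx)) in
    ¬x≡y×S≡By (x≡y , ⊆-antisym S⊆By (subst (λ z → bag D z ⊆ S) x≡y Bx⊆S))

  refined⇒bag∖S⊆component : Refined D → ∀ {y S C} → S ⊆ bag D y → IsComponent G S C →
    ∀ {x u w} → u ∈ bag D x → u ∈ C → w ∈ bag D x → w ∉ S → w ∈ C
  refined⇒bag∖S⊆component refined {y} {S} {C} S⊆By C-comp {w = w} u∈Bx u∈C w∈Bx w∉S with w ∈? C
  ... | yes w∈C = w∈C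
  ... | no w∉C  = ⊥-elim (refined⇒¬bag-straddles D refined y (component-separation C-comp) separator⊆By
                            u∈Bx (λ u∈∁C → x∈∁p⇒x∉p u∈∁C u∈C)
                            w∈Bx (λ w∈C∪S → [ w∉C , w∉S ]′ (x∈p∪q⁻ C S w∈C∪S)))
    where
    open Components G S
    separator⊆By : ∀ {u} → u ∈ C ∪ S → u ∈ ∁ C → u ∈ bag D y
    separator⊆By u∈C∪S u∈∁C = S⊆By ([ (λ u∈C → ⊥-elim (x∈∁p⇒x∉p u∈∁C u∈C)) , id ]′ (x∈p∪q⁻ C S u∈C∪S))

lemma7 : ∀ {n} (G : Graph n) (D : TreeDecomposition G) → Refined D →
         ∀ (x y : Fin (m D)) (S : Subset n) → S ⊆ bag D y →
         ¬ (x ≡ y × S ≡ bag D y) →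
         MeetsExactlyOneComponent G S (bag D x)
lemma7 G D refined@(normal , _) x y S S⊆By ¬x≡y×S≡By
  with normal⇒bag-⊈-separator D normal S⊆By ¬x≡y×S≡By
... | v , v∈Bx , v∉S =
  component v , C-comp , (v , v∈C , v∈Bx) , λ C′ C′-comp (w , w∈C′ , w∈Bx) →
    IsComponent-≡ C-comp C′-comp
      (refined⇒bag∖S⊆component D refined S⊆By C-comp v∈Bx v∈C w∈Bx (IsComponent-∉ C′-comp w∈C′))
      w∈C′
  where
  open Components G S

  C-comp : IsComponent G S (component v)
  C-comp = component-isComponent v∉S

  v∈C : v ∈ component v
  v∈C = ∈-toSubset⁺ (Reach? v) (here v∉S)
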